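{- Let $A$ be an $n\times n$ alternating sign matrix whose Dyck island is described by a single boundary loop $\gamma$. Let $v=(i,j)$ be a lattice point on the southwest boundary $\mathrm{swb}(\gamma)$ that is a corner of type $ud$ or $du$ of the Dyck word of $\mathrm{swb}(\gamma)$. Then the contribution of $v$, \[ \sum_{\substack{i'<i,\ j'>j}} A_{ij}A_{i'j'}, \] equals $\operatorname{height}(v)$ if $A_{ij}=1$ and $-\operatorname{height}(v)$ if $A_{ij}=-1$, where $\operatorname{height}(v)=i-j$. (Thus the contribution is $\pm\operatorname{height}(v)$.)
   Context: An alternating sign matrix (ASM) of size $n$ is an $n\times n$ matrix with entries in $\{0,1,-1\}$ such that every row and column sums to $1$ and nonzero entries alternate in sign along each row and column. Its height function is $h_{ij}=i+j-2\sum_{i'\le i,\,j'\le j}A_{i'j'}$ for $0\le i,j\le n$. Let $h^{(0)}_{ij}=|i-j|$. The Dyck island of $A$ is $\delta_{ij}=\tfrac12(h_{ij}-h^{(0)}_{ij})$, $1\le i,j\le n-1$. Geometric picture. $A_{ij}$ sits at the lattice point $(i,j)$, with rows increasing downward and columns to the right. The value $\delta_{ij}$ sits in the unit box with corners $(i,j),(i+1,j),(i,j+1),(i+1,j+1)$. "Described by a single boundary loop $\gamma$" means $\delta=1$ on the boxes enclosed by a closed lattice loop $\gamma$ and $0$ elsewhere. The loop has the following form: - Its northeast boundary runs from a diagonal point $(a,a)$ to $(b,b)$, $a<b$, by right and down unit steps, staying in $\{j\ge i\}$. - Its southwest boundary $\mathrm{swb}(\gamma)$ runs from $(a,a)$ to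 $(b,b)$ by down and right unit steps, staying in $\{i\ge j\}$. Encode $\mathrm{swb}(\gamma)$ as a Dyck word, with a down step written $u$ (away from the diagonal) and a right step written $d$ (toward the diagonal). A point $v$ of the path is of type $ud$ (resp. $du$) if the step entering $v$ is $u$ and the step leaving $v$ is $d$ (resp. $d$ then $u$). The set of lattice points $(i',j')$ with $i'<i$ and $j'>j$ is the region strictly above and strictly to the right of $v$. -}

module Defs where

open import Data.Nat using (ℕ; zero; suc; _≤_; _<_; _<?_; _∸_)
open import Data.Integer using (ℤ; +_; _+_; _-_; _*_; -_; 0ℤ; 1ℤ; -1ℤ; ∣_∣; _⊖_)
open import Data.Integer.DivMod using (_/ℕ_)
open import Data.Fin using (Fin; fromℕ<)
open import Data.List using (List; []; _∷_; map; foldr; filter; allFin)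
open import Data.List.Relation.Unary.All using (All)
open import Data.Product using (_×_; _,_; ∃-syntax)
open import Data.Sum using (_⊎_)
open import Relation.Binary.PropositionalEquality using (_≡_)
open import Relation.Nullary using (yes; no; ¬_)
open import Relation.Nullary.Decidable using (¬?)
import Data.Integer as ℤ

Matrix : ℕ → Set
Matrix n = Fin n → Fin n → ℤ

-- entry A i j = A_{ij} for 1 ≤ i,j ≤ n (1-based), and 0 outside.
entry : ∀ {n} → Matrix n → ℕ → ℕ → ℤ
entry A zero _ = 0ℤ
entry A (suc i) zero = 0ℤ
entry {n} A (suc i) (suc j) with i <? n | j <? n
... | yes p | yes q = A (fromℕ< p) (fromℕ< q)
... | _ | _ = 0ℤ

sumℤ : List ℤ → ℤ
sumℤ = foldr _+_ 0ℤ

sumTo : ℕ → (ℕ → ℤ) → ℤ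
sumTo zero f = 0ℤ
sumTo (suc k) f = sumTo k f + f (suc k)

data Alternates : List ℤ → Set where
  alt-[] : Alternates []
  alt-[x] : ∀ {x} → Alternates (x ∷ [])
  alt-∷ : ∀ {x y xs} → y ≡ - x → Alternates (y ∷ xs) → Alternates (x ∷ y ∷ xs)

nonzeros : List ℤ → List ℤ
nonzeros = filter (λ x → ¬? (x ℤ.≟ 0ℤ))

row : ∀ {n} → Matrix n → Fin n → List ℤ
row {n} A i = map (λ j → A i j) (allFin n)

col : ∀ {n} → Matrix n → Fin n → List ℤ
col {n} A j = map (λ i → A i j) (allFin n)

record IsASM {n : ℕ} (A : Matrix n) : Set where
  field
    entries  : ∀ i j → (A i j ≡ 0ℤ) ⊎ (A i j ≡ 1ℤ) ⊎ (A i j ≡ -1ℤ)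
    rowSum   : ∀ i → sumℤ (row A i) ≡ 1ℤ
    colSum   : ∀ j → sumℤ (col A j) ≡ 1ℤ
    rowAlt   : ∀ i → Alternates (nonzeros (row A i))
    colAlt   : ∀ j → Alternates (nonzeros (col A j))

cornerSum : ∀ {n} → Matrix n → ℕ → ℕ → ℤ
cornerSum A i j = sumTo i (λ i' → sumTo j (λ j' → entry A i' j'))

height : ∀ {n} → Matrix n → ℕ → ℕ → ℤ
height A i j = (+ i + + j) - (+ 2) * cornerSum A i j

height0 : ℕ → ℕ → ℤ
height0 i j = + ∣ i ⊖ j ∣

dyck : ∀ {n} → Matrix n → ℕ → ℕ → ℤ
dyck A i j = (height A i j - height0 i j) /ℕ 2

-- Lattice paths.  A point is (i , j): i = row (increasing downward),
-- j = column (increasing to the right).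

Point : Set
Point = ℕ × ℕ

data Step : Set where
  down  : Step
  right : Step

move : Point → Step → Point
move (i , j) down  = (suc i , j)
move (i , j) right = (i , suc j)

points : Point → List Step → List Point
points p [] = p ∷ []
points p (s ∷ ss) = p ∷ points (move p s) ss

endpoint : Point → List Step → Point
endpoint p [] = p
endpoint p (s ∷ ss) = endpoint (move p s) ss

-- DownStepAt p ss q : the path starting at p with steps ss contains the
-- down step from q = (i , c) to (i + 1 , c).
data DownStepAt : Point → List Step → Point → Set where
  here  : ∀ {p ss} → DownStepAt p (down ∷ ss) p
  there : ∀ {p s ss q} → DownStepAt (move p s) ss q → DownStepAt p (s ∷ ss) q

-- CornerAt p ss e l v : v is a point of the path (start p, steps ss)
-- such that the step entering v is e and the step leaving v is l.
data CornerAt : Point → List Step → Step → Step → Point → Set where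
  here  : ∀ {p e l ss} → CornerAt p (e ∷ l ∷ ss) e l (move p e)
  there : ∀ {p s ss e l v} → CornerAt (move p s) ss e l v → CornerAt p (s ∷ ss) e l v

InGrid : ℕ → Point → Set
InGrid n (i , j) = (1 ≤ i × i ≤ n) × (1 ≤ j × j ≤ n)

AboveDiag : Point → Set
AboveDiag (i , j) = i ≤ j

BelowDiag : Point → Set
BelowDiag (i , j) = j ≤ i

record IsNEBoundary (n a b : ℕ) (ss : List Step) : Set where
  field
    ends   : endpoint (a , a) ss ≡ (b , b)
    region : All AboveDiag (points (a , a) ss)
    grid   : All (InGrid n) (points (a , a) ss)

record IsSWBoundary (n a b : ℕ) (ss : List Step) : Set where
  field
    ends   : endpoint (a , a) ss ≡ (b , b)
    region : All BelowDiag (points (a , a) ss)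
    grid   : All (InGrid n) (points (a , a) ss)

-- The unit box with top-left corner (i , j) is enclosed by the loop
-- formed by ne and sw (both starting at (a,a)): in the horizontal strip
-- between rows i and i+1, the box lies between the down step of the
-- southwest boundary (column c₁) and that of the northeast boundary
-- (column c₂).
Enclosed : ℕ → List Step → List Step → ℕ → ℕ → Set
Enclosed a ne sw i j =
  ∃[ c₁ ] ∃[ c₂ ] (DownStepAt (a , a) sw (i , c₁) × DownStepAt (a , a) ne (i , c₂)
                   × c₁ ≤ j × j < c₂)

-- "The Dyck island of A is described by the single boundary loop (ne, sw)":
-- δ = 1 on enclosed boxes and 0 elsewhere (1 ≤ i,j ≤ n-1).
DescribedByLoop : ∀ {n} → Matrix n → ℕ → List Step → List Step → Set
DescribedByLoop {n} A a ne sw =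
  ∀ i j → 1 ≤ i → i < n → 1 ≤ j → j < n →
    (Enclosed a ne sw i j → dyck A i j ≡ 1ℤ) × (¬ Enclosed a ne sw i j → dyck A i j ≡ 0ℤ)

-- Contribution of v = (i , j):  Σ_{i' < i, j' > j} A_{ij} A_{i'j'}
-- (i', j' ranging over 1..n).

contribution : ∀ {n} → Matrix n → ℕ → ℕ → ℤ
contribution {n} A i j =
  sumTo (i ∸ 1) (λ i' → sumTo (n ∸ j) (λ k → entry A i j * entry A i' (j Data.Nat.+ k)))

heightOf : Point → ℤ
heightOf (i , j) = + i - + j

module Submission where

-- Write C(p,q) = Σ_{i'≤p, j'≤q} A_{i'j'} for the corner sums of A.
--
-- (1) Since p + q = 2·min(p,q) + |p-q|, the Dyck island is δ_{pq} = min(p,q) - C(p,q).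
--     Hence the loop hypothesis pins down C on every box, and an entry of A, being a
--     second difference of C, is a second difference of min - δ.
-- (2) Every row of an ASM sums to 1, so the entries strictly above and strictly right of
--     v = (i,j) add up to the "north-east mass" (i-1) - C(i-1,j), and the contribution of
--     v is A_{ij} times this mass.
-- (3) A monotone lattice path crosses every row between its ends by exactly one down step,
--     and the columns of these steps increase with the row.  For the two boundaries of γ
--     this decides the box (i-1,j) just north-east of a ud/du corner v of swb(γ): it is
--     enclosed when v lies strictly below the diagonal, giving C(i-1,j) = j-1; for a du
--     corner on the diagonal it is not, giving C(i-1,j) = i-1 = j-1 (otherwise the boxes
--     around v would force A_{ii} = 0).
-- Either way the north-east mass is i - j = height(v), and the theorem follows from (2).

open import Defs
open import Data.Nat using (ℕ; _<_)
open import Data.Integer using (ℤ; 1ℤ; -1ℤ; -_)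
open import Data.List using (List)
open import Data.Product using (_×_; _,_)
open import Data.Sum using (_⊎_)
open import Relation.Binary.PropositionalEquality using (_≡_)

open import Data.Nat as ℕ using (zero; suc; z≤n; s≤s; _≤_; _⊓_; _∸_)
import Data.Nat.Properties as ℕP
open import Data.Integer using (+_; -[1+_]; _+_; _-_; _*_; 0ℤ; ∣_∣; _⊖_)
import Data.Integer.Properties as ℤP
open import Data.Integer.DivMod using (_/ℕ_; _%ℕ_; n%ℕd<d; a≡a%ℕn+[a/ℕn]*n)
open import Data.Integer.Tactic.RingSolver using (solve-∀)
open import Relation.Binary.PropositionalEquality using (_≢_; refl; sym; trans; cong; cong₂; subst; module ≡-Reasoning)
open import Data.Empty using (⊥-elim)
open import Data.Product using (∃-syntax; proj₁; proj₂)
open import Data.Sum using (inj₁; inj₂)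
open import Data.List using ([]; _∷_; tabulate)
open import Data.List.Relation.Unary.All as All using (All; _∷_)
open import Data.List.Properties using (map-tabulate)
open import Data.Fin using (Fin; fromℕ<)
open import Relation.Nullary using (¬_; yes; no)
open import Function using (_∘_; id)

double≢1 : ∀ y → y + y ≢ 1ℤ
double≢1 (+ zero) ()
double≢1 (+ suc k) eq with trans (sym (ℕP.+-suc k k)) (ℕP.suc-injective (ℤP.+-injective eq))
... | ()
double≢1 -[1+ k ] ()

half-double : ∀ x → (x + x) /ℕ 2 ≡ x
half-double x with (x + x) %ℕ 2 | n%ℕd<d (x + x) 2 | a≡a%ℕn+[a/ℕn]*n (x + x) 2
... | zero | _ | even =
  sym (ℤP.*-cancelʳ-≡ x ((x + x) /ℕ 2) (+ 2) (trans (twice x) (trans even (ℤP.+-identityˡ _))))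
  where
  twice : ∀ x → x * + 2 ≡ x + x
  twice = solve-∀
... | suc zero | _ | odd = ⊥-elim (double≢1 (x - q) (trans (rearrange x q) (trans (cong (_- q * + 2) odd) (cancel q))))
  where
  q = (x + x) /ℕ 2
  rearrange : ∀ x q → (x - q) + (x - q) ≡ (x + x) - q * + 2
  rearrange = solve-∀
  cancel : ∀ q → (+ 1 + q * + 2) - q * + 2 ≡ + 1
  cancel = solve-∀
... | suc (suc _) | s≤s (s≤s ()) | _

pos-split : ∀ {m n} → m ≤ n → + n ≡ + m + + (n ∸ m)
pos-split {m} {n} m≤n = trans (cong +_ (sym (ℕP.m+[n∸m]≡n m≤n))) (ℤP.pos-+ m (n ∸ m))

sum-as-min : ∀ p q → + p + + q ≡ + (p ⊓ q) + + (p ⊓ q) + + ∣ p ⊖ q ∣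
sum-as-min p q with ℕP.≤-total p q
... | inj₁ p≤q rewrite ℕP.m≤n⇒m⊓n≡m p≤q | ℤP.∣⊖∣-≤ p≤q =
  trans (cong (λ z → + p + z) (pos-split p≤q)) (regroup (+ p) (+ (q ∸ p)))
  where
  regroup : ∀ p d → p + (p + d) ≡ p + p + d
  regroup = solve-∀
... | inj₂ q≤p rewrite ℕP.m≥n⇒m⊓n≡n q≤p | ℤP.∣m⊖n∣≡∣n⊖m∣ p q | ℤP.∣⊖∣-≤ q≤p =
  trans (cong (_+ + q) (pos-split q≤p)) (regroup (+ q) (+ (p ∸ q)))
  where
  regroup : ∀ q d → (q + d) + q ≡ q + q + d
  regroup = solve-∀

sumTo-cong : ∀ m (f g : ℕ → ℤ) → (∀ k → 1 ≤ k → k ≤ m → f k ≡ g k) → sumTo m f ≡ sumTo m g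
sumTo-cong zero f g f≗g = refl
sumTo-cong (suc m) f g f≗g =
  cong₂ _+_ (sumTo-cong m f g (λ k 1≤k k≤m → f≗g k 1≤k (ℕP.m≤n⇒m≤1+n k≤m))) (f≗g (suc m) (s≤s z≤n) ℕP.≤-refl)

sumTo-scale : ∀ m c (f : ℕ → ℤ) → sumTo m (λ k → c * f k) ≡ c * sumTo m f
sumTo-scale zero c f = sym (ℤP.*-zeroʳ c)
sumTo-scale (suc m) c f =
  trans (cong (_+ c * f (suc m)) (sumTo-scale m c f)) (sym (ℤP.*-distribˡ-+ c (sumTo m f) (f (suc m))))

sumTo-sub : ∀ m (f g : ℕ → ℤ) → sumTo m (λ k → f k - g k) ≡ sumTo m f - sumTo m g
sumTo-sub zero f g = refl
sumTo-sub (suc m) f g =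
  trans (cong (_+ (f (suc m) - g (suc m))) (sumTo-sub m f g)) (interchange (sumTo m f) (sumTo m g) (f (suc m)) (g (suc m)))
  where
  interchange : ∀ a b x y → (a - b) + (x - y) ≡ (a + x) - (b + y)
  interchange = solve-∀

sumTo-one : ∀ m → sumTo m (λ _ → 1ℤ) ≡ + m
sumTo-one zero = refl
sumTo-one (suc m) = trans (cong (_+ 1ℤ) (sumTo-one m)) (trans (sym (ℤP.pos-+ m 1)) (cong +_ (ℕP.+-comm m 1)))

sumTo-split : ∀ j d (f : ℕ → ℤ) → sumTo (j ℕ.+ d) f ≡ sumTo j f + sumTo d (λ k → f (j ℕ.+ k))
sumTo-split j zero f = trans (cong (λ m → sumTo m f) (ℕP.+-identityʳ j)) (sym (ℤP.+-identityʳ _))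
sumTo-split j (suc d) f rewrite ℕP.+-suc j d =
  trans (cong (_+ f (suc (j ℕ.+ d))) (sumTo-split j d f)) (ℤP.+-assoc (sumTo j f) _ _)

sumTo-shift : ∀ m (f : ℕ → ℤ) → sumTo (suc m) f ≡ f 1 + sumTo m (f ∘ suc)
sumTo-shift zero f = ℤP.+-comm 0ℤ (f 1)
sumTo-shift (suc m) f = trans (cong (_+ f (suc (suc m))) (sumTo-shift m f)) (ℤP.+-assoc (f 1) _ _)

sumℤ-tabulate : ∀ m (h : Fin m → ℤ) (f : ℕ → ℤ) → (∀ k (k<m : k < m) → f (suc k) ≡ h (fromℕ< k<m)) →
                sumℤ (tabulate h) ≡ sumTo m f
sumℤ-tabulate zero h f f≗h = refl
sumℤ-tabulate (suc m) h f f≗h =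
  trans (cong₂ _+_ (sym (f≗h 0 (s≤s z≤n))) (sumℤ-tabulate m (h ∘ Fin.suc) (f ∘ suc) (λ k k<m → f≗h (suc k) (s≤s k<m))))
        (sym (sumTo-shift m f))

-- Corner sums and the Dyck island (valid for every square integer matrix)

module CornerSums {n : ℕ} (A : Matrix n) where

  C : ℕ → ℕ → ℤ
  C = cornerSum A

  dyck≡min-C : ∀ p q → dyck A p q ≡ + (p ⊓ q) - C p q
  dyck≡min-C p q = trans (cong (_/ℕ 2) doubled) (half-double (+ (p ⊓ q) - C p q))
    where
    M = + (p ⊓ q)
    regroup : ∀ M D c → (M + M + D - + 2 * c) - D ≡ (M - c) + (M - c)
    regroup = solve-∀
    doubled : height A p q - height0 p q ≡ (M - C p q) + (M - C p q)
    doubled = trans (cong (λ s → (s - + 2 * C p q) - + ∣ p ⊖ q ∣) (sum-as-min p q)) (regroup M (+ ∣ p ⊖ q ∣) (C p q))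

  C-from-dyck : ∀ p q m v → p ⊓ q ≡ m → dyck A p q ≡ + v → C p q ≡ + m - + v
  C-from-dyck p q m v min≡m δ≡v =
    trans (solve (C p q) (+ (p ⊓ q))) (cong₂ _-_ (cong +_ min≡m) (trans (sym (dyck≡min-C p q)) δ≡v))
    where
    solve : ∀ c M → c ≡ M - (M - c)
    solve = solve-∀

  -- A diagonal entry is 1 minus the second difference of δ around it, because the
  -- second difference of min(p,q) is 1 exactly on the diagonal.
  diagonal-entry : ∀ m → entry A (suc m) (suc m)
    ≡ 1ℤ - (dyck A (suc m) (suc m) - dyck A m (suc m) - dyck A (suc m) m + dyck A m m)
  diagonal-entry m
    rewrite dyck≡min-C (suc m) (suc m) | dyck≡min-C m (suc m) | dyck≡min-C (suc m) m | dyck≡min-C m m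
          | ℕP.⊓-idem m | ℕP.m≤n⇒m⊓n≡m (ℕP.n≤1+n m) | ℕP.m≥n⇒m⊓n≡n (ℕP.n≤1+n m) =
    second-difference (+ m) (C m (suc m)) (C m m) (sumTo m (entry A (suc m))) (entry A (suc m) (suc m))
    where
    -- C(m+1,m+1) unfolds to C(m,m+1) + r + A_{m+1,m+1} and C(m+1,m) to C(m,m) + r,
    -- where r is the sum of row m+1 up to column m.
    second-difference : ∀ M t w r x → x ≡ 1ℤ - ((+ 1 + M - (t + (r + x))) - (M - t) - (M - (w + r)) + (M - w))
    second-difference = solve-∀

-- Row sums of an ASM and the contribution of a point

-- Σ_{i'<i, j'>j} A_{i'j'}, computed through the row sums: (i-1) - C(i-1,j).
northeastMass : ∀ {n} → Matrix n → ℕ → ℕ → ℤ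
northeastMass A i j = + (i ∸ 1) - cornerSum A (i ∸ 1) j

module Rows {n : ℕ} (A : Matrix n) (asm : IsASM A) where

  entry-fromℕ< : ∀ i (i<n : i < n) j (j<n : j < n) → entry A (suc i) (suc j) ≡ A (fromℕ< i<n) (fromℕ< j<n)
  entry-fromℕ< i i<n j j<n with i ℕ.<? n | j ℕ.<? n
  ... | yes _ | yes _ = refl
  ... | no i≮n | _ = ⊥-elim (i≮n i<n)
  ... | yes _ | no j≮n = ⊥-elim (j≮n j<n)

  row-sum : ∀ i → 1 ≤ i → i ≤ n → sumTo n (entry A i) ≡ 1ℤ
  row-sum (suc i) _ i<n = begin
    sumTo n (entry A (suc i))            ≡⟨ sumℤ-tabulate n (A I) (entry A (suc i)) (entry-fromℕ< i i<n) ⟨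
    sumℤ (tabulate (A I))                ≡⟨ cong sumℤ (map-tabulate id (A I)) ⟨
    sumℤ (row A I)                       ≡⟨ IsASM.rowSum asm I ⟩
    1ℤ                                   ∎
    where
    open ≡-Reasoning
    I = fromℕ< i<n

  row-tail : ∀ j k → j ≤ n → 1 ≤ k → k ≤ n →
    sumTo (n ∸ j) (λ t → entry A k (j ℕ.+ t)) ≡ 1ℤ - sumTo j (entry A k)
  row-tail j k j≤n 1≤k k≤n = trans (difference _ _ _ split) (cong (_- sumTo j (entry A k)) (row-sum k 1≤k k≤n))
    where
    split : sumTo n (entry A k) ≡ sumTo j (entry A k) + sumTo (n ∸ j) (λ t → entry A k (j ℕ.+ t))
    split = trans (cong (λ m → sumTo m (entry A k)) (sym (ℕP.m+[n∸m]≡n j≤n))) (sumTo-split j (n ∸ j) (entry A k))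
    difference : ∀ s a r → s ≡ a + r → r ≡ s - a
    difference s a r refl = solve a r
      where
      solve : ∀ a r → r ≡ (a + r) - a
      solve = solve-∀

  contribution-factor : ∀ i j → i ≤ n → j ≤ n → contribution A i j ≡ entry A i j * northeastMass A i j
  contribution-factor i j i≤n j≤n = begin
    contribution A i j
      ≡⟨ sumTo-cong m _ _ (λ k _ _ → sumTo-scale (n ∸ j) e (λ t → entry A k (j ℕ.+ t))) ⟩
    sumTo m (λ k → e * sumTo (n ∸ j) (λ t → entry A k (j ℕ.+ t)))
      ≡⟨ sumTo-scale m e _ ⟩
    e * sumTo m (λ k → sumTo (n ∸ j) (λ t → entry A k (j ℕ.+ t)))
      ≡⟨ cong (e *_) (sumTo-cong m _ _ (λ k 1≤k k≤m → row-tail j k j≤n 1≤k (ℕP.≤-trans k≤m m≤n))) ⟩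
    e * sumTo m (λ k → 1ℤ - sumTo j (entry A k))
      ≡⟨ cong (e *_) (sumTo-sub m (λ _ → 1ℤ) (λ k → sumTo j (entry A k))) ⟩
    e * (sumTo m (λ _ → 1ℤ) - cornerSum A m j)
      ≡⟨ cong (λ s → e * (s - cornerSum A m j)) (sumTo-one m) ⟩
    e * northeastMass A i j
      ∎
    where
    open ≡-Reasoning
    m = i ∸ 1
    e = entry A i j
    m≤n : m ≤ n
    m≤n = ℕP.≤-trans (ℕP.m∸n≤m i 1) i≤n

-- Monotone lattice paths (down/right steps from an arbitrary start p)

_≼_ : Point → Point → Set
p ≼ q = proj₁ p ≤ proj₁ q × proj₂ p ≤ proj₂ q

≼-refl : ∀ p → p ≼ p
≼-refl p = ℕP.≤-refl , ℕP.≤-refl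

≼-trans : ∀ {p q r} → p ≼ q → q ≼ r → p ≼ r
≼-trans (x≤x' , y≤y') (x'≤x'' , y'≤y'') = ℕP.≤-trans x≤x' x'≤x'' , ℕP.≤-trans y≤y' y'≤y''

≼-move : ∀ p s → p ≼ move p s
≼-move (x , y) down = ℕP.n≤1+n x , ℕP.≤-refl
≼-move (x , y) right = ℕP.≤-refl , ℕP.n≤1+n y

≼-endpoint : ∀ p ss → p ≼ endpoint p ss
≼-endpoint p [] = ≼-refl p
≼-endpoint p (s ∷ ss) = ≼-trans (≼-move p s) (≼-endpoint (move p s) ss)

between : ∀ p ss → All (λ q → p ≼ q × q ≼ endpoint p ss) (points p ss)
between p [] = (≼-refl p , ≼-refl p) ∷ All.[]
between p (s ∷ ss) = (≼-refl p , ≼-endpoint p (s ∷ ss)) ∷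
  All.map (λ { (p'≼q , q≼e) → ≼-trans (≼-move p s) p'≼q , q≼e }) (between (move p s) ss)

at-start : ∀ {P : Point → Set} p ss → All P (points p ss) → P p
at-start p [] (Pp ∷ _) = Pp
at-start p (_ ∷ _) (Pp ∷ _) = Pp

at-end : ∀ {P : Point → Set} p ss → All P (points p ss) → P (endpoint p ss)
at-end p [] (Pp ∷ _) = Pp
at-end p (s ∷ ss) (_ ∷ Pss) = at-end (move p s) ss Pss

at-down : ∀ {P : Point → Set} {p ss q} → DownStepAt p ss q → All P (points p ss) → P q × P (move q down)
at-down {ss = _ ∷ ss} here (Pq ∷ Pss) = Pq , at-start _ ss Pss
at-down (there d) (_ ∷ Pss) = at-down d Pss

down-after-start : ∀ {p ss q} → DownStepAt p ss q → p ≼ q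
down-after-start {p} here = ≼-refl p
down-after-start {p} (there {s = s} d) = ≼-trans (≼-move p s) (down-after-start d)

down-exists : ∀ p ss r → proj₁ p ≤ r → r < proj₁ (endpoint p ss) → ∃[ c ] DownStepAt p ss (r , c)
down-exists (x , y) [] r x≤r r<x = ⊥-elim (ℕP.<-irrefl refl (ℕP.≤-<-trans x≤r r<x))
down-exists (x , y) (down ∷ ss) r x≤r r<e with x ℕP.≟ r
... | yes refl = y , here
... | no x≢r with down-exists (suc x , y) ss r (ℕP.≤∧≢⇒< x≤r x≢r) r<e
...   | c , d = c , there d
down-exists (x , y) (right ∷ ss) r x≤r r<e with down-exists (x , suc y) ss r x≤r r<e
... | c , d = c , there d

down-unique : ∀ {p ss r c c'} → DownStepAt p ss (r , c) → DownStepAt p ss (r , c') → c ≡ c'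
down-unique here here = refl
down-unique here (there d) = ⊥-elim (ℕP.<-irrefl refl (proj₁ (down-after-start d)))
down-unique (there d) here = ⊥-elim (ℕP.<-irrefl refl (proj₁ (down-after-start d)))
down-unique (there d) (there d') = down-unique d d'

down-monotone : ∀ {p ss r c r' c'} → DownStepAt p ss (r , c) → DownStepAt p ss (r' , c') → r < r' → c ≤ c'
down-monotone here here r<r = ⊥-elim (ℕP.<-irrefl refl r<r)
down-monotone here (there d) _ = proj₂ (down-after-start d)
down-monotone (there d) here r<r' = ⊥-elim (ℕP.<-asym r<r' (proj₁ (down-after-start d)))
down-monotone (there d) (there d') r<r' = down-monotone d d' r<r'

at-corner : ∀ {P : Point → Set} {p ss e l v} → CornerAt p ss e l v → All P (points p ss) → P v
at-corner {ss = e ∷ l ∷ ss} here (_ ∷ Pss) = at-start _ (l ∷ ss) Pss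
at-corner (there c) (_ ∷ Pss) = at-corner c Pss

corner-entered-from : ∀ {P : Point → Set} {p ss e l v} → CornerAt p ss e l v → All P (points p ss) →
  ∃[ u ] (move u e ≡ v × P u)
corner-entered-from {p = p} here (Pp ∷ _) = p , refl , Pp
corner-entered-from (there c) (_ ∷ Pss) = corner-entered-from c Pss

corner-entered-down : ∀ {p ss l v} → CornerAt p ss down l v → ∃[ u ] (move u down ≡ v × DownStepAt p ss u)
corner-entered-down {p = p} here = p , refl , here
corner-entered-down (there c) with corner-entered-down c
... | u , u↦v , d = u , u↦v , there d

corner-left-down : ∀ {p ss e v} → CornerAt p ss e down v → DownStepAt p ss v
corner-left-down here = there here
corner-left-down (there c) = there (corner-left-down c)

-- The loop γ and the boxes next to the corners of swb(γ)

module Loop {n : ℕ} (A : Matrix n) (a b : ℕ) (ne sw : List Step)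
  (neB : IsNEBoundary n a b ne) (swB : IsSWBoundary n a b sw)
  (loop : DescribedByLoop A a ne sw) where

  open CornerSums A

  Confined : (Point → Set) → Point → Set
  Confined side q = side q × (a , a) ≼ q × q ≼ (b , b)

  confined : ∀ {side ss} → endpoint (a , a) ss ≡ (b , b) → All side (points (a , a) ss) →
    All (Confined side) (points (a , a) ss)
  confined {ss = ss} ends region =
    All.zip (region , subst (λ e → All (λ q → (a , a) ≼ q × q ≼ e) (points (a , a) ss)) ends (between (a , a) ss))

  swConfined : All (Confined BelowDiag) (points (a , a) sw)
  swConfined = confined (IsSWBoundary.ends swB) (IsSWBoundary.region swB)

  neConfined : All (Confined AboveDiag) (points (a , a) ne)
  neConfined = confined (IsNEBoundary.ends neB) (IsNEBoundary.region neB)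

  1≤a : 1 ≤ a
  1≤a = proj₁ (proj₁ (at-start (a , a) sw (IsSWBoundary.grid swB)))

  b≤n : b ≤ n
  b≤n = proj₂ (proj₁ (subst (InGrid n) (IsSWBoundary.ends swB) (at-end (a , a) sw (IsSWBoundary.grid swB))))

  sw-down : ∀ r → a ≤ r → r < b → ∃[ c ] DownStepAt (a , a) sw (r , c)
  sw-down r a≤r r<b = down-exists (a , a) sw r a≤r (subst (λ e → r < proj₁ e) (sym (IsSWBoundary.ends swB)) r<b)

  ne-down : ∀ r → a ≤ r → r < b → ∃[ c ] (r < c × DownStepAt (a , a) ne (r , c))
  ne-down r a≤r r<b with down-exists (a , a) ne r a≤r (subst (λ e → r < proj₁ e) (sym (IsNEBoundary.ends neB)) r<b)
  ... | c , d = c , proj₁ (proj₂ (at-down d neConfined)) , d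

  loop-at : ∀ {r j} → a ≤ r → r < b → a ≤ j → j < b →
    (Enclosed a ne sw r j → dyck A r j ≡ 1ℤ) × (¬ Enclosed a ne sw r j → dyck A r j ≡ 0ℤ)
  loop-at {r} {j} a≤r r<b a≤j j<b =
    loop r j (ℕP.≤-trans 1≤a a≤r) (ℕP.<-≤-trans r<b b≤n) (ℕP.≤-trans 1≤a a≤j) (ℕP.<-≤-trans j<b b≤n)

  -- A box below the diagonal not left of swb(γ) in its row is enclosed: neb(γ) passes right of the diagonal.
  enclosed-below : ∀ {r c j} → DownStepAt (a , a) sw (r , c) → c ≤ j → j ≤ r → a ≤ r → r < b →
    Enclosed a ne sw r j
  enclosed-below {r} {c} sw-r c≤j j≤r a≤r r<b with ne-down r a≤r r<b
  ... | c₂ , r<c₂ , ne-r = c , c₂ , sw-r , ne-r , c≤j , ℕP.≤-<-trans j≤r r<c₂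

  mass-below : ∀ {r c j} → DownStepAt (a , a) sw (r , c) → c ≤ j → j ≤ r → a ≤ j → r < b →
    northeastMass A (suc r) j ≡ heightOf (suc r , j)
  mass-below {r} {c} {j} sw-r c≤j j≤r a≤j r<b = begin
    + r - C r j              ≡⟨ cong (λ s → + r - s) C≡j-1 ⟩
    + r - (+ j - + 1)        ≡⟨ shift (+ r) (+ j) ⟩
    + suc r - + j            ∎
    where
    open ≡-Reasoning
    a≤r = ℕP.≤-trans a≤j j≤r
    C≡j-1 : C r j ≡ + j - + 1
    C≡j-1 = C-from-dyck r j j 1 (ℕP.m≥n⇒m⊓n≡n j≤r)
      (proj₁ (loop-at a≤r r<b a≤j (ℕP.≤-<-trans j≤r r<b)) (enclosed-below sw-r c≤j j≤r a≤r r<b))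
    shift : ∀ R J → R - (J - + 1) ≡ (+ 1 + R) - J
    shift = solve-∀

  -- If swb(γ) leaves the diagonal point (m+1,m+1) downwards while neb(γ) crosses row m
  -- strictly right of it, the boxes around (m+1,m+1) have δ = 1, 1, 1 and (for (m+1,m)) 0,
  -- so A_{m+1,m+1} = 0.
  diagonal-entry-zero : ∀ {m c₂} → DownStepAt (a , a) sw (suc m , suc m) → DownStepAt (a , a) ne (m , c₂) →
    suc m < c₂ → a ≤ m → suc m < b → entry A (suc m) (suc m) ≡ 0ℤ
  diagonal-entry-zero {m} {c₂} sw-v ne-m m+1<c₂ a≤m m+1<b
    with sw-down m a≤m (ℕP.<⇒≤ m+1<b) | ne-down (suc m) (ℕP.m≤n⇒m≤1+n a≤m) m+1<b
  ... | c₁ , sw-m | c₃ , _ , ne-m+1 = begin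
    entry A (suc m) (suc m)
      ≡⟨ diagonal-entry m ⟩
    1ℤ - (dyck A (suc m) (suc m) - dyck A m (suc m) - dyck A (suc m) m + dyck A m m)
      ≡⟨ cong₂ (λ s t → 1ℤ - (s - t - dyck A (suc m) m + dyck A m m)) δ[m+1,m+1] δ[m,m+1] ⟩
    1ℤ - (1ℤ - 1ℤ - dyck A (suc m) m + dyck A m m)
      ≡⟨ cong₂ (λ s t → 1ℤ - (1ℤ - 1ℤ - s + t)) δ[m+1,m] δ[m,m] ⟩
    0ℤ
      ∎
    where
    open ≡-Reasoning
    a≤m+1 = ℕP.m≤n⇒m≤1+n a≤m
    m<b = ℕP.<⇒≤ m+1<b
    c₁≤m : c₁ ≤ m
    c₁≤m = proj₁ (proj₁ (at-down sw-m swConfined))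
    m+1<c₃ : suc m < c₃
    m+1<c₃ = ℕP.<-≤-trans m+1<c₂ (down-monotone ne-m ne-m+1 ℕP.≤-refl)
    δ[m+1,m+1] : dyck A (suc m) (suc m) ≡ 1ℤ
    δ[m+1,m+1] = proj₁ (loop-at a≤m+1 m+1<b a≤m+1 m+1<b) (suc m , c₃ , sw-v , ne-m+1 , ℕP.≤-refl , m+1<c₃)
    δ[m,m+1] : dyck A m (suc m) ≡ 1ℤ
    δ[m,m+1] = proj₁ (loop-at a≤m m<b a≤m+1 m+1<b)
      (c₁ , c₂ , sw-m , ne-m , ℕP.m≤n⇒m≤1+n c₁≤m , m+1<c₂)
    δ[m,m] : dyck A m m ≡ 1ℤ
    δ[m,m] = proj₁ (loop-at a≤m m<b a≤m m<b) (c₁ , c₂ , sw-m , ne-m , c₁≤m , ℕP.<⇒≤ m+1<c₂)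
    -- in row m+1 swb(γ) goes down at column m+1, right of the box (m+1,m)
    outside : ¬ Enclosed a ne sw (suc m) m
    outside (c , _ , sw-m+1 , _ , c≤m , _) with down-unique sw-m+1 sw-v
    ... | refl = ℕP.<-irrefl refl c≤m
    δ[m+1,m] : dyck A (suc m) m ≡ 0ℤ
    δ[m+1,m] = proj₂ (loop-at a≤m+1 m+1<b a≤m m<b) outside

  -- At a corner (m+1,m+1) on the diagonal where swb(γ) goes down and A ≠ 0, neb(γ) must pass
  -- through (m+1,m+1); so the box (m,m+1) is outside, C(m,m+1) = m and the mass is 0 = height.
  mass-diagonal : ∀ {m} → DownStepAt (a , a) sw (suc m , suc m) → a ≤ m → suc m < b →
    entry A (suc m) (suc m) ≢ 0ℤ → northeastMass A (suc m) (suc m) ≡ heightOf (suc m , suc m)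
  mass-diagonal {m} sw-v a≤m m+1<b A≢0 with ne-down m a≤m (ℕP.<⇒≤ m+1<b)
  ... | c₂ , m<c₂ , ne-m with ℕP.m≤n⇒m<n∨m≡n m<c₂
  ...   | inj₁ m+1<c₂ = ⊥-elim (A≢0 (diagonal-entry-zero sw-v ne-m m+1<c₂ a≤m m+1<b))
  ...   | inj₂ refl = begin
    + m - C m (suc m)       ≡⟨ cong (λ s → + m - s) C≡m ⟩
    + m - (+ m - + 0)       ≡⟨ cancel (+ m) (+ suc m) ⟩
    + suc m - + suc m       ∎
    where
    open ≡-Reasoning
    outside : ¬ Enclosed a ne sw m (suc m)
    outside (_ , c , _ , ne-m' , _ , m+1<c) with down-unique ne-m' ne-m
    ... | refl = ℕP.<-irrefl refl m+1<c
    C≡m : C m (suc m) ≡ + m - + 0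
    C≡m = C-from-dyck m (suc m) m 0 (ℕP.m≤n⇒m⊓n≡m (ℕP.n≤1+n m))
      (proj₂ (loop-at a≤m (ℕP.<⇒≤ m+1<b) (ℕP.m≤n⇒m≤1+n a≤m) m+1<b) outside)
    cancel : ∀ M N → M - (M - + 0) ≡ N - N
    cancel = solve-∀

  SWCorner : ℕ → ℕ → Set
  SWCorner i j = CornerAt (a , a) sw down right (i , j) ⊎ CornerAt (a , a) sw right down (i , j)

  corner-in-square : ∀ {i j} → SWCorner i j → (i , j) ≼ (b , b)
  corner-in-square (inj₁ ud) = proj₂ (proj₂ (at-corner ud swConfined))
  corner-in-square (inj₂ du) = proj₂ (proj₂ (at-corner du swConfined))

  -- The key fact: at a ud or du corner v of swb(γ) with A_v ≠ 0 the north-east mass is height(v).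
  -- ud corner (r+1,c): the box (r,c) is enclosed.  du corner (x,c+1) strictly below the
  -- diagonal, x = r+1: the box (r,c+1) is enclosed.  du corner on the diagonal: mass-diagonal.
  mass-at-corner : ∀ i j → SWCorner i j → entry A i j ≢ 0ℤ → northeastMass A i j ≡ heightOf (i , j)
  mass-at-corner i j (inj₁ ud) _ with corner-entered-down ud
  ... | (r , c) , refl , sw-r with at-down sw-r swConfined
  ...   | (c≤r , (_ , a≤c) , _) , (_ , _ , (r<b , _)) = mass-below sw-r ℕP.≤-refl c≤r a≤c r<b
  mass-at-corner i j (inj₂ du) A≢0 with corner-entered-from du swConfined | corner-left-down du
  ... | (x , c) , refl , (_ , (_ , a≤c) , _) | sw-v with at-down sw-v swConfined
  ...   | (c<x , _) , (_ , _ , (x<b , _)) with ℕP.m≤n⇒m<n∨m≡n c<x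
  ...     | inj₂ refl = mass-diagonal sw-v a≤c x<b A≢0
  ...     | inj₁ (s≤s c<r) with sw-down _ (ℕP.≤-trans a≤c (ℕP.<⇒≤ c<r)) (ℕP.<⇒≤ x<b)
  ...       | c₁ , sw-r = mass-below sw-r (down-monotone sw-r sw-v ℕP.≤-refl) c<r (ℕP.m≤n⇒m≤1+n a≤c) (ℕP.<⇒≤ x<b)

mainTheorem3 : (n : ℕ) (A : Matrix n) → IsASM A →
    (a b : ℕ) (ne sw : List Step) → a < b →
    IsNEBoundary n a b ne → IsSWBoundary n a b sw →
    DescribedByLoop A a ne sw →
    (i j : ℕ) →
    (CornerAt (a , a) sw down right (i , j) ⊎ CornerAt (a , a) sw right down (i , j)) →
    (entry A i j ≡ 1ℤ → contribution A i j ≡ heightOf (i , j))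
    × (entry A i j ≡ -1ℤ → contribution A i j ≡ - heightOf (i , j))
mainTheorem3 n A asm a b ne sw _ neB swB loop i j corner =
    (λ A≡1 → trans (unit-entry A≡1 (λ ())) (ℤP.*-identityˡ _))
  , (λ A≡-1 → trans (unit-entry A≡-1 (λ ())) (ℤP.-1*i≡-i _))
  where
  open Loop A a b ne sw neB swB loop
  v≼b : (i , j) ≼ (b , b)
  v≼b = corner-in-square corner
  unit-entry : ∀ {s} → entry A i j ≡ s → s ≢ 0ℤ → contribution A i j ≡ s * heightOf (i , j)
  unit-entry refl s≢0 =
    trans (Rows.contribution-factor A asm i j (ℕP.≤-trans (proj₁ v≼b) b≤n) (ℕP.≤-trans (proj₂ v≼b) b≤n))
          (cong (entry A i j *_) (mass-at-corner i j corner s≢0))
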